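{- Let $f \in \mathbb{N}_0[x^{\pm 1}]$ with $|\operatorname{supp}(f)| \ge 3$, and suppose there is a prime number $p$ with $\frac{5 f(1)}{6} - 1 \le p \le f(1) - 2$. Then $f$ can be written as the sum of two irreducible elements of $\mathbb{N}_0[x^{\pm 1}]$.
   Context: $\mathbb{N}_0[x^{\pm 1}]$ denotes the commutative semiring of Laurent polynomials in $x$ with nonnegative integer coefficients. Its units are exactly the monomials $x^k$, $k \in \mathbb{Z}$. An element is irreducible if it is nonzero, not a unit, and cannot be written as a product of two non-units. The support $\operatorname{supp}(f)$ is the set of exponents appearing in $f$ with nonzero coefficient, and $f(1)$ is the sum of the coefficients of $f$. -}

module Defs where

open import Data.Nat as ℕ using (ℕ; zero; suc)
open import Data.Integer as ℤ using (ℤ; +_; -[1+_]; _⊓_; ∣_∣)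
open import Data.List using (List; []; _∷_; map; replicate; _++_)
open import Data.Nat.ListAction using (sum)
open import Data.Product using (Σ; ∃; _×_; _,_)
open import Data.Sum using (_⊎_)
open import Relation.Binary.PropositionalEquality using (_≡_)
open import Relation.Nullary using (¬_)

-- Polynomials in ℕ[x] as coefficient lists (constant term first)
addP : List ℕ → List ℕ → List ℕ
addP [] ys = ys
addP (x ∷ xs) [] = x ∷ xs
addP (x ∷ xs) (y ∷ ys) = (x ℕ.+ y) ∷ addP xs ys

scaleP : ℕ → List ℕ → List ℕ
scaleP a = map (a ℕ.*_)

mulP : List ℕ → List ℕ → List ℕ
mulP [] ys = []
mulP (x ∷ xs) ys = addP (scaleP x ys) (0 ∷ mulP xs ys)

lookupD : List ℕ → ℕ → ℕ
lookupD [] _ = 0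
lookupD (x ∷ xs) zero = x
lookupD (x ∷ xs) (suc n) = lookupD xs n

-- An element of ℕ₀[x^{±1}] is represented as x^low * (Σ_i cs[i] x^i).
record LP : Set where
  constructor lp
  field
    low : ℤ
    cs  : List ℕ
open LP public

coeff : LP → ℤ → ℕ
coeff f n with n ℤ.- low f
... | + d = lookupD (cs f) d
... | -[1+ _ ] = 0

infix 4 _≈_
_≈_ : LP → LP → Set
f ≈ g = ∀ n → coeff f n ≡ coeff g n

infixl 6 _⊕_
infixl 7 _⊗_
_⊕_ : LP → LP → LP
f ⊕ g =
  let m = low f ⊓ low g in
  lp m (addP (replicate ∣ low f ℤ.- m ∣ 0 ++ cs f)
             (replicate ∣ low g ℤ.- m ∣ 0 ++ cs g))

_⊗_ : LP → LP → LP
f ⊗ g = lp (low f ℤ.+ low g) (mulP (cs f) (cs g))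

zeroLP : LP
zeroLP = lp (+ 0) []

oneLP : LP
oneLP = lp (+ 0) (1 ∷ [])

eval1 : LP → ℕ
eval1 f = sum (cs f)

IsUnit : LP → Set
IsUnit u = ∃ λ v → u ⊗ v ≈ oneLP

Irreducible : LP → Set
Irreducible f =
  ¬ (f ≈ zeroLP) × ¬ IsUnit f ×
  (∀ g h → f ≈ g ⊗ h → IsUnit g ⊎ IsUnit h)

SuppAtLeast3 : LP → Set
SuppAtLeast3 f = Σ ℤ λ i → Σ ℤ λ j → Σ ℤ λ k →
  i ℤ.< j × j ℤ.< k ×
  ¬ (coeff f i ≡ 0) × ¬ (coeff f j ≡ 0) × ¬ (coeff f k ≡ 0)

-- Write f(1) = p + 2 + r and let [t₁, tₖ] be the span of the exponents of f. The bound
-- 5 f(1) ≤ 6 (p + 1) says f(1) ≥ 6 (r + 1), so one of the three parts of f with exponents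
-- below, at, or above the midpoint (t₁ + tₖ) / 2 has coefficient sum greater than r. Let h
-- be r + 1 units of that part plus the monomial at the end of the span on the other side
-- (x^tₖ for the lower part, x^t₁ otherwise), and g = f − h. Then g(1) = p is prime, and
-- since evaluation at 1 is multiplicative and units evaluate to 1, g is irreducible. The
-- anchoring monomial makes h irreducible: it has a coefficient equal to 1, and no two inner
-- exponents of h add up to the sum of its extreme exponents.

module Submission where

open import Data.Empty using (⊥-elim)
open import Data.Integer as ℤ using (ℤ; -[1+_]; _⊖_) renaming (+_ to pos)
import Data.Integer.Properties as ℤ
open import Data.Integer.Tactic.RingSolver using (solve-∀)
open import Data.List using (List; []; _∷_; replicate; _++_)
open import Data.Nat using (ℕ; zero; suc; _+_; _*_; _∸_; _⊓_; _≤_; _<_; z≤n; s≤s; z<s)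
open import Data.Nat.Divisibility
  using (_∣_; divides; ∣m⇒∣m*n; ∣n⇒∣m*n; ∣m∣n⇒∣m+n; _∣0; ∣-refl; ∣1⇒≡1)
open import Data.Nat.ListAction using (sum)
open import Data.Nat.Primality using (Prime; prime⇒irreducible; prime⇒nonZero; ¬prime[0]; ¬prime[1])
open import Data.Nat.Properties
open import Data.Nat.Tactic.RingSolver using () renaming (solve-∀ to ℕ-solve-∀)
open import Data.Product using (Σ; ∃; ∃₂; _×_; _,_; proj₁; proj₂; uncurry)
open import Data.Sum using (_⊎_; inj₁; inj₂; [_,_]′; map₂)
open import Function using (_∘_; id; case_of_)
open import Relation.Binary.Definitions using (tri<; tri≈; tri>)
open import Relation.Binary.PropositionalEquality
open import Relation.Nullary using (¬_; Dec; yes; no)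
open import Relation.Nullary.Decidable using (decidable-stable)

open import Algebra.Properties.CommutativeSemigroup +-commutativeSemigroup using (interchange)
open import Algebra.Properties.CommutativeSemigroup ℤ.+-commutativeSemigroup
  using () renaming (interchange to ℤ-interchange)

open import Defs

-- Coefficient lists

_∈suppL_ : ℕ → List ℕ → Set
d ∈suppL xs = lookupD xs d ≢ 0

lookupD-addP : ∀ xs ys d → lookupD (addP xs ys) d ≡ lookupD xs d + lookupD ys d
lookupD-addP []       ys       d       = refl
lookupD-addP (x ∷ xs) []       zero    = sym (+-identityʳ x)
lookupD-addP (x ∷ xs) []       (suc d) = sym (+-identityʳ _)
lookupD-addP (x ∷ xs) (y ∷ ys) zero    = refl
lookupD-addP (x ∷ xs) (y ∷ ys) (suc d) = lookupD-addP xs ys d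

lookupD-scaleP : ∀ a ys d → lookupD (scaleP a ys) d ≡ a * lookupD ys d
lookupD-scaleP a []       d       = sym (*-zeroʳ a)
lookupD-scaleP a (y ∷ ys) zero    = refl
lookupD-scaleP a (y ∷ ys) (suc d) = lookupD-scaleP a ys d

lookupD-mulP-∷ : ∀ x xs ys d →
  lookupD (mulP (x ∷ xs) ys) d ≡ x * lookupD ys d + lookupD (0 ∷ mulP xs ys) d
lookupD-mulP-∷ x xs ys d =
  trans (lookupD-addP (scaleP x ys) _ d) (cong (_+ _) (lookupD-scaleP x ys d))

sum-addP : ∀ xs ys → sum (addP xs ys) ≡ sum xs + sum ys
sum-addP []       ys       = refl
sum-addP (x ∷ xs) []       = sym (+-identityʳ _)
sum-addP (x ∷ xs) (y ∷ ys) =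
  trans (cong (x + y +_) (sum-addP xs ys)) (interchange x y (sum xs) (sum ys))

sum-scaleP : ∀ a ys → sum (scaleP a ys) ≡ a * sum ys
sum-scaleP a []       = sym (*-zeroʳ a)
sum-scaleP a (y ∷ ys) =
  trans (cong (a * y +_) (sum-scaleP a ys)) (sym (*-distribˡ-+ a y (sum ys)))

sum-mulP : ∀ xs ys → sum (mulP xs ys) ≡ sum xs * sum ys
sum-mulP []       ys = refl
sum-mulP (x ∷ xs) ys = begin
  sum (addP (scaleP x ys) (0 ∷ mulP xs ys)) ≡⟨ sum-addP (scaleP x ys) _ ⟩
  sum (scaleP x ys) + sum (mulP xs ys)      ≡⟨ cong₂ _+_ (sum-scaleP x ys) (sum-mulP xs ys) ⟩
  x * sum ys + sum xs * sum ys              ≡⟨ *-distribʳ-+ (sum ys) x (sum xs) ⟨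
  (x + sum xs) * sum ys                     ∎
  where open ≡-Reasoning

sum-≗ : ∀ xs ys → lookupD xs ≗ lookupD ys → sum xs ≡ sum ys
sum-≗ []       []       eq = refl
sum-≗ []       (y ∷ ys) eq = cong₂ _+_ (eq 0) (sum-≗ [] ys (eq ∘ suc))
sum-≗ (x ∷ xs) []       eq = cong₂ _+_ (eq 0) (sum-≗ xs [] (eq ∘ suc))
sum-≗ (x ∷ xs) (y ∷ ys) eq = cong₂ _+_ (eq 0) (sum-≗ xs ys (eq ∘ suc))

sum-replicate0-++ : ∀ k ys → sum (replicate k 0 ++ ys) ≡ sum ys
sum-replicate0-++ zero    ys = refl
sum-replicate0-++ (suc k) ys = sum-replicate0-++ k ys

sum≡0⇒lookupD≡0 : ∀ xs → sum xs ≡ 0 → ∀ d → lookupD xs d ≡ 0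
sum≡0⇒lookupD≡0 []       _  d       = refl
sum≡0⇒lookupD≡0 (x ∷ xs) s0 zero    = m+n≡0⇒m≡0 x s0
sum≡0⇒lookupD≡0 (x ∷ xs) s0 (suc d) = sum≡0⇒lookupD≡0 xs (m+n≡0⇒n≡0 x s0) d

sum≡1⇒monomial : ∀ xs → sum xs ≡ 1 →
  ∃ λ i → lookupD xs i ≡ 1 × (∀ d → d ≢ i → lookupD xs d ≡ 0)
sum≡1⇒monomial (zero ∷ xs) s1 with sum≡1⇒monomial xs s1
... | i , xs[i]≡1 , rest = suc i , xs[i]≡1 , λ where
  zero    _    → refl
  (suc d) d≢i → rest d (d≢i ∘ cong suc)
sum≡1⇒monomial (suc zero ∷ xs) s1 = 0 , refl , λ where
  zero    0≢0 → ⊥-elim (0≢0 refl)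
  (suc d) _   → sum≡0⇒lookupD≡0 xs (suc-injective s1) d

mulP-identityʳ : ∀ xs → lookupD (mulP xs (1 ∷ [])) ≗ lookupD xs
mulP-identityʳ []       d       = refl
mulP-identityʳ (x ∷ xs) zero    = trans (+-identityʳ _) (*-identityʳ x)
mulP-identityʳ (x ∷ xs) (suc d) = mulP-identityʳ xs d

mulP-nonzero : ∀ xs ys i j → i ∈suppL xs → j ∈suppL ys → (i + j) ∈suppL mulP xs ys
mulP-nonzero []       ys i       j xs[i]≢0 _       = xs[i]≢0
mulP-nonzero (x ∷ xs) ys zero    j x≢0     ys[j]≢0 eq
  with m*n≡0⇒m≡0∨n≡0 x (m+n≡0⇒m≡0 _ (trans (sym (lookupD-mulP-∷ x xs ys j)) eq))
... | inj₁ x≡0     = x≢0 x≡0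
... | inj₂ ys[j]≡0 = ys[j]≢0 ys[j]≡0
mulP-nonzero (x ∷ xs) ys (suc i) j xs[i]≢0 ys[j]≢0 eq =
  mulP-nonzero xs ys i j xs[i]≢0 ys[j]≢0
    (m+n≡0⇒n≡0 _ (trans (sym (lookupD-mulP-∷ x xs ys (suc (i + j)))) eq))

mulP-support : ∀ xs ys d → d ∈suppL mulP xs ys → ∃₂ λ i j → i + j ≡ d × i ∈suppL xs × j ∈suppL ys
mulP-support []       ys d       nz = ⊥-elim (nz refl)
mulP-support (x ∷ xs) ys d       nz with x * lookupD ys d ≟ 0
... | no xy≢0 = 0 , d , refl , (λ x≡0 → xy≢0 (cong (_* lookupD ys d) x≡0))
                             , (λ y≡0 → xy≢0 (trans (cong (x *_) y≡0) (*-zeroʳ x)))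
mulP-support (x ∷ xs) ys zero    nz | yes xy≡0 =
  ⊥-elim (nz (trans (lookupD-mulP-∷ x xs ys 0) (trans (+-identityʳ _) xy≡0)))
mulP-support (x ∷ xs) ys (suc d) nz | yes xy≡0
  with mulP-support xs ys d (λ tail≡0 → nz (trans (lookupD-mulP-∷ x xs ys (suc d)) (cong₂ _+_ xy≡0 tail≡0)))
... | i , j , i+j≡d , xs[i]≢0 , ys[j]≢0 = suc i , j , cong suc i+j≡d , xs[i]≢0 , ys[j]≢0

∣-lookupD-0∷ : ∀ {c} xs → (∀ d → c ∣ lookupD xs d) → ∀ d → c ∣ lookupD (0 ∷ xs) d
∣-lookupD-0∷ xs c∣xs zero    = _ ∣0
∣-lookupD-0∷ xs c∣xs (suc d) = c∣xs d

∣-mulPˡ : ∀ {c} xs ys → (∀ i → c ∣ lookupD xs i) → ∀ d → c ∣ lookupD (mulP xs ys) d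
∣-mulPˡ []       ys c∣xs d = _ ∣0
∣-mulPˡ (x ∷ xs) ys c∣xs d = subst (_ ∣_) (sym (lookupD-mulP-∷ x xs ys d))
  (∣m∣n⇒∣m+n (∣m⇒∣m*n _ (c∣xs 0)) (∣-lookupD-0∷ _ (∣-mulPˡ xs ys (c∣xs ∘ suc)) d))

∣-mulPʳ : ∀ {c} xs ys → (∀ j → c ∣ lookupD ys j) → ∀ d → c ∣ lookupD (mulP xs ys) d
∣-mulPʳ []       ys c∣ys d = _ ∣0
∣-mulPʳ (x ∷ xs) ys c∣ys d = subst (_ ∣_) (sym (lookupD-mulP-∷ x xs ys d))
  (∣m∣n⇒∣m+n (∣n⇒∣m*n x (c∣ys d)) (∣-lookupD-0∷ _ (∣-mulPʳ xs ys c∣ys) d))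

-- Laurent polynomials

n≡m+[n-m] : ∀ n m → n ≡ m ℤ.+ (n ℤ.- m)
n≡m+[n-m] = solve-∀

n≡m-[m-n] : ∀ n m → n ≡ m ℤ.- (m ℤ.- n)
n≡m-[m-n] = solve-∀

lookupℤ : List ℕ → ℤ → ℕ
lookupℤ xs (pos d)  = lookupD xs d
lookupℤ xs -[1+ _ ] = 0

lookupℤ-cong : ∀ xs ys → lookupD xs ≗ lookupD ys → lookupℤ xs ≗ lookupℤ ys
lookupℤ-cong xs ys eq (pos d)  = eq d
lookupℤ-cong xs ys eq -[1+ _ ] = refl

coeff≡lookupℤ : ∀ f n → coeff f n ≡ lookupℤ (cs f) (n ℤ.- low f)
coeff≡lookupℤ f n with n ℤ.- low f
... | pos d    = refl
... | -[1+ _ ] = refl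

coeff-lp : ∀ l xs i → coeff (lp l xs) (l ℤ.+ pos i) ≡ lookupD xs i
coeff-lp l xs i = trans (coeff≡lookupℤ (lp l xs) (l ℤ.+ pos i)) (cong (lookupℤ xs) (m+n-m≡n l (pos i)))
  where
  m+n-m≡n : ∀ m n → m ℤ.+ n ℤ.- m ≡ n
  m+n-m≡n = solve-∀

lp-cong : ∀ l xs ys → lookupD xs ≗ lookupD ys → lp l xs ≈ lp l ys
lp-cong l xs ys eq n = trans (coeff≡lookupℤ (lp l xs) n)
  (trans (lookupℤ-cong xs ys eq (n ℤ.- l)) (sym (coeff≡lookupℤ (lp l ys) n)))

⊕-lp : ∀ l xs ys → lp l xs ⊕ lp l ys ≈ lp l (addP xs ys)
⊕-lp l xs ys n rewrite ℤ.⊓-idem l | ℤ.+-inverseʳ l = refl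

_∈supp_ : ℤ → LP → Set
n ∈supp f = coeff f n ≢ 0

lp-support : ∀ l xs n → n ∈supp lp l xs → ∃ λ i → n ≡ l ℤ.+ pos i × i ∈suppL xs
lp-support l xs n n∈ with n ℤ.- l in eq | coeff≡lookupℤ (lp l xs) n
... | pos i    | coeff≡ = i , trans (n≡m+[n-m] n l) (cong (ℤ._+_ l) eq) , n∈ ∘ trans coeff≡
... | -[1+ _ ] | coeff≡ = ⊥-elim (n∈ coeff≡)

lp-exponent-⊗ : ∀ la lb i j → la ℤ.+ lb ℤ.+ pos (i + j) ≡ la ℤ.+ pos i ℤ.+ (lb ℤ.+ pos j)
lp-exponent-⊗ la lb i j =
  trans (cong (ℤ._+_ (la ℤ.+ lb)) (ℤ.pos-+ i j)) (ℤ-interchange la lb (pos i) (pos j))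

shift-cancel-< : ∀ l a b → l ℤ.+ pos a ℤ.< l ℤ.+ pos b → a < b
shift-cancel-< l a b lt = ℤ.drop‿+<+
  (subst₂ ℤ._<_ (-m+[m+n]≡n l (pos a)) (-m+[m+n]≡n l (pos b)) (ℤ.+-monoʳ-< (ℤ.- l) lt))
  where
  -m+[m+n]≡n : ∀ m n → ℤ.- m ℤ.+ (m ℤ.+ n) ≡ n
  -m+[m+n]≡n = solve-∀

shift-cancel-+ : ∀ l a b c d →
  l ℤ.+ pos a ℤ.+ (l ℤ.+ pos b) ≡ l ℤ.+ pos c ℤ.+ (l ℤ.+ pos d) → a + b ≡ c + d
shift-cancel-+ l a b c d eq = ℤ.+-injective (begin
  pos (a + b)                                       ≡⟨ ℤ.pos-+ a b ⟩
  pos a ℤ.+ pos b                                   ≡⟨ unshift l (pos a) (pos b) ⟨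
  ℤ.- (l ℤ.+ l) ℤ.+ (l ℤ.+ pos a ℤ.+ (l ℤ.+ pos b)) ≡⟨ cong (ℤ._+_ (ℤ.- (l ℤ.+ l))) eq ⟩
  ℤ.- (l ℤ.+ l) ℤ.+ (l ℤ.+ pos c ℤ.+ (l ℤ.+ pos d)) ≡⟨ unshift l (pos c) (pos d) ⟩
  pos c ℤ.+ pos d                                   ≡⟨ ℤ.pos-+ c d ⟨
  pos (c + d)                                       ∎)
  where
  open ≡-Reasoning
  unshift : ∀ l x y → ℤ.- (l ℤ.+ l) ℤ.+ (l ℤ.+ x ℤ.+ (l ℤ.+ y)) ≡ x ℤ.+ y
  unshift = solve-∀

⊗-nonzero : ∀ A B a b → a ∈supp A → b ∈supp B → (a ℤ.+ b) ∈supp (A ⊗ B)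
⊗-nonzero (lp la xs) (lp lb ys) a b a∈ b∈ with lp-support la xs a a∈ | lp-support lb ys b b∈
... | i , refl , xs[i]≢0 | j , refl , ys[j]≢0 = λ coeff≡0 →
  mulP-nonzero xs ys i j xs[i]≢0 ys[j]≢0 (begin
    lookupD (mulP xs ys) (i + j)                                     ≡⟨ coeff-lp (la ℤ.+ lb) _ (i + j) ⟨
    coeff (lp la xs ⊗ lp lb ys) (la ℤ.+ lb ℤ.+ pos (i + j))          ≡⟨ cong (coeff _) (lp-exponent-⊗ la lb i j) ⟩
    coeff (lp la xs ⊗ lp lb ys) (la ℤ.+ pos i ℤ.+ (lb ℤ.+ pos j))    ≡⟨ coeff≡0 ⟩
    0                                                                ∎)
  where open ≡-Reasoning

⊗-support : ∀ A B n → n ∈supp (A ⊗ B) → ∃₂ λ a b → a ℤ.+ b ≡ n × a ∈supp A × b ∈supp B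
⊗-support (lp la xs) (lp lb ys) n n∈ with lp-support (la ℤ.+ lb) (mulP xs ys) n n∈
... | d , refl , zs[d]≢0 with mulP-support xs ys d zs[d]≢0
... | i , j , refl , xs[i]≢0 , ys[j]≢0 =
  la ℤ.+ pos i , lb ℤ.+ pos j , sym (lp-exponent-⊗ la lb i j) ,
  xs[i]≢0 ∘ trans (sym (coeff-lp la xs i)) , ys[j]≢0 ∘ trans (sym (coeff-lp lb ys j))

∣-lookupℤ : ∀ {c} xs → (∀ d → c ∣ lookupD xs d) → ∀ n → c ∣ lookupℤ xs n
∣-lookupℤ xs c∣xs (pos d)  = c∣xs d
∣-lookupℤ xs c∣xs -[1+ _ ] = _ ∣0

∣-coeff : ∀ {c} f → (∀ d → c ∣ lookupD (cs f) d) → ∀ n → c ∣ coeff f n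
∣-coeff f c∣cs n = subst (_ ∣_) (sym (coeff≡lookupℤ f n)) (∣-lookupℤ (cs f) c∣cs (n ℤ.- low f))

∣-cs : ∀ {c} f → (∀ n → c ∣ coeff f n) → ∀ d → c ∣ lookupD (cs f) d
∣-cs f c∣f d = subst (_ ∣_) (coeff-lp (low f) (cs f) d) (c∣f (low f ℤ.+ pos d))

∣-⊗ˡ : ∀ {c} A B → (∀ a → c ∣ coeff A a) → ∀ n → c ∣ coeff (A ⊗ B) n
∣-⊗ˡ A B c∣A = ∣-coeff (A ⊗ B) (∣-mulPˡ (cs A) (cs B) (∣-cs A c∣A))

∣-⊗ʳ : ∀ {c} A B → (∀ b → c ∣ coeff B b) → ∀ n → c ∣ coeff (A ⊗ B) n
∣-⊗ʳ A B c∣B = ∣-coeff (A ⊗ B) (∣-mulPʳ (cs A) (cs B) (∣-cs B c∣B))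

lookupℤ-⊖ : ∀ ys d k → lookupℤ ys (d ⊖ k) ≡ lookupD (replicate k 0 ++ ys) d
lookupℤ-⊖ ys d       zero    = refl
lookupℤ-⊖ ys zero    (suc k) = refl
lookupℤ-⊖ ys (suc d) (suc k) =
  trans (cong (lookupℤ ys) (ℤ.[1+m]⊖[1+n]≡m⊖n d k)) (lookupℤ-⊖ ys d k)

eval1-cong-shift : ∀ l xs k ys → lp l xs ≈ lp (l ℤ.+ pos k) ys → sum xs ≡ sum ys
eval1-cong-shift l xs k ys f≈g = trans (sum-≗ xs (replicate k 0 ++ ys) padded) (sum-replicate0-++ k ys)
  where
  open ≡-Reasoning
  exponent : ∀ a b c → a ℤ.+ b ℤ.- (a ℤ.+ c) ≡ b ℤ.- c
  exponent = solve-∀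
  padded : lookupD xs ≗ lookupD (replicate k 0 ++ ys)
  padded d = begin
    lookupD xs d                                  ≡⟨ coeff-lp l xs d ⟨
    coeff (lp l xs) (l ℤ.+ pos d)                 ≡⟨ f≈g (l ℤ.+ pos d) ⟩
    coeff (lp (l ℤ.+ pos k) ys) (l ℤ.+ pos d)     ≡⟨ coeff≡lookupℤ (lp (l ℤ.+ pos k) ys) (l ℤ.+ pos d) ⟩
    lookupℤ ys (l ℤ.+ pos d ℤ.- (l ℤ.+ pos k))    ≡⟨ cong (lookupℤ ys) (exponent l (pos d) (pos k)) ⟩
    lookupℤ ys (pos d ℤ.- pos k)                  ≡⟨ cong (lookupℤ ys) (ℤ.m-n≡m⊖n d k) ⟩
    lookupℤ ys (d ⊖ k)                            ≡⟨ lookupℤ-⊖ ys d k ⟩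
    lookupD (replicate k 0 ++ ys) d               ∎

eval1-cong : ∀ f g → f ≈ g → eval1 f ≡ eval1 g
eval1-cong (lp lf xs) (lp lg ys) f≈g with lg ℤ.- lf in eq
... | pos k    = eval1-cong-shift lf xs k ys
  (subst (λ l → lp lf xs ≈ lp l ys) (trans (n≡m+[n-m] lg lf) (cong (ℤ._+_ lf) eq)) f≈g)
... | -[1+ k ] = sym (eval1-cong-shift lg ys (suc k) xs
  (subst (λ l → lp lg ys ≈ lp l xs) (trans (n≡m-[m-n] lf lg) (cong (ℤ._-_ lg) eq)) (sym ∘ f≈g)))

eval1-⊗ : ∀ g A B → g ≈ A ⊗ B → eval1 g ≡ eval1 A * eval1 B
eval1-⊗ g A B g≈AB = trans (eval1-cong g (A ⊗ B) g≈AB) (sum-mulP (cs A) (cs B))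

IsUnit⇒eval1≡1 : ∀ u → IsUnit u → eval1 u ≡ 1
IsUnit⇒eval1≡1 u (v , uv≈1) = m*n≡1⇒m≡1 (eval1 u) (eval1 v) (sym (eval1-⊗ oneLP u v (sym ∘ uv≈1)))

⊗-monomial : ∀ A k n → coeff (A ⊗ lp k (1 ∷ [])) n ≡ coeff A (n ℤ.- k)
⊗-monomial (lp l xs) k n = begin
  coeff (lp (l ℤ.+ k) (mulP xs (1 ∷ []))) n   ≡⟨ coeff≡lookupℤ (lp (l ℤ.+ k) _) n ⟩
  lookupℤ (mulP xs (1 ∷ [])) (n ℤ.- (l ℤ.+ k))
    ≡⟨ lookupℤ-cong (mulP xs (1 ∷ [])) xs (mulP-identityʳ xs) (n ℤ.- (l ℤ.+ k)) ⟩
  lookupℤ xs (n ℤ.- (l ℤ.+ k))                 ≡⟨ cong (lookupℤ xs) (exponent n l k) ⟩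
  lookupℤ xs (n ℤ.- k ℤ.- l)                   ≡⟨ coeff≡lookupℤ (lp l xs) (n ℤ.- k) ⟨
  coeff (lp l xs) (n ℤ.- k)                    ∎
  where
  open ≡-Reasoning
  exponent : ∀ n l k → n ℤ.- (l ℤ.+ k) ≡ n ℤ.- k ℤ.- l
  exponent = solve-∀

monomial-unit : ∀ A a → coeff A a ≡ 1 → (∀ n → n ≢ a → coeff A n ≡ 0) → IsUnit A
monomial-unit A a A[a]≡1 A[n]≡0 = lp (ℤ.- a) (1 ∷ []) , λ n → trans (⊗-monomial A (ℤ.- a) n) (at n)
  where
  shifted≢a : ∀ n → n ≢ pos 0 → n ℤ.- ℤ.- a ≢ a
  shifted≢a n n≢0 eq = n≢0 (begin
    n                      ≡⟨ n≡n-[-a]-a n a ⟩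
    n ℤ.- ℤ.- a ℤ.- a      ≡⟨ cong (ℤ._- a) eq ⟩
    a ℤ.- a                ≡⟨ ℤ.+-inverseʳ a ⟩
    pos 0                  ∎)
    where
    open ≡-Reasoning
    n≡n-[-a]-a : ∀ n a → n ≡ n ℤ.- ℤ.- a ℤ.- a
    n≡n-[-a]-a = solve-∀
  at : ∀ n → coeff A (n ℤ.- ℤ.- a) ≡ coeff oneLP n
  at (pos zero)    = trans (cong (coeff A) (trans (ℤ.+-identityˡ _) (ℤ.neg-involutive a))) A[a]≡1
  at (pos (suc d)) = A[n]≡0 _ (shifted≢a (pos (suc d)) λ ())
  at -[1+ k ]      = A[n]≡0 _ (shifted≢a -[1+ k ] λ ())

eval1≡1⇒IsUnit : ∀ A → eval1 A ≡ 1 → IsUnit A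
eval1≡1⇒IsUnit (lp l xs) sum≡1 with sum≡1⇒monomial xs sum≡1
... | i , xs[i]≡1 , xs[d]≡0 =
  monomial-unit (lp l xs) (l ℤ.+ pos i) (trans (coeff-lp l xs i) xs[i]≡1) off
  where
  off : ∀ n → n ≢ l ℤ.+ pos i → coeff (lp l xs) n ≡ 0
  off n n≢ = decidable-stable (_ ≟ 0) λ n∈ → case lp-support l xs n n∈ of λ where
    (d , refl , xs[d]≢0) → xs[d]≢0 (xs[d]≡0 d (n≢ ∘ cong (λ j → l ℤ.+ pos j)))

prime-eval1⇒Irreducible : ∀ g → Prime (eval1 g) → Irreducible g
prime-eval1⇒Irreducible g p-prime = g≉0 , g-nonunit , factor-unit
  where
  instance _ = prime⇒nonZero p-prime
  g≉0 : ¬ g ≈ zeroLP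
  g≉0 g≈0 = ¬prime[0] (subst Prime (eval1-cong g zeroLP g≈0) p-prime)
  g-nonunit : ¬ IsUnit g
  g-nonunit u = ¬prime[1] (subst Prime (IsUnit⇒eval1≡1 g u) p-prime)
  factor-unit : ∀ A B → g ≈ A ⊗ B → IsUnit A ⊎ IsUnit B
  factor-unit A B g≈AB
    with prime⇒irreducible p-prime (divides (eval1 B) (trans (eval1-⊗ g A B g≈AB) (*-comm (eval1 A) _)))
  ... | inj₁ A≡1 = inj₁ (eval1≡1⇒IsUnit A A≡1)
  ... | inj₂ A≡g = inj₂ (eval1≡1⇒IsUnit B (*-cancelˡ-≡ (eval1 B) 1 (eval1 g) (begin
    eval1 g * eval1 B ≡⟨ cong (_* eval1 B) A≡g ⟨
    eval1 A * eval1 B ≡⟨ eval1-⊗ g A B g≈AB ⟨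
    eval1 g           ≡⟨ *-identityʳ (eval1 g) ⟨
    eval1 g * 1       ∎)))
    where open ≡-Reasoning

-- Irreducibility from the shape of the support

record Extrema {A : Set} (_≤_ : A → A → Set) (P : A → Set) (m M : A) : Set where
  field
    min∈  : P m
    max∈  : P M
    min≤  : ∀ d → P d → m ≤ d
    ≤max  : ∀ d → P d → d ≤ M

NoInnerPair : {A : Set} → (A → A → Set) → (A → A → A) → (A → Set) → A → A → Set
NoInnerPair _<_ _+_ P m M =
  ∀ u v → P u → P v → m < u → u < M → m < v → v < M → u + v ≢ m + M

≈-supp : ∀ {f g} → f ≈ g → ∀ n → n ∈supp g → n ∈supp f
≈-supp f≈g n n∈g f[n]≡0 = n∈g (trans (sym (f≈g n)) f[n]≡0)

single-support-∣ : ∀ A a → (∀ n → n ∈supp A → n ≡ a) → ∀ n → coeff A a ∣ coeff A n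
single-support-∣ A a supp≡a n with coeff A n ≟ 0
... | yes A[n]≡0 = subst (_ ∣_) (sym A[n]≡0) (_ ∣0)
... | no  n∈     = subst (λ k → coeff A a ∣ coeff A k) (sym (supp≡a n n∈)) ∣-refl

single-support-unit : ∀ A a → (∀ n → n ∈supp A → n ≡ a) → coeff A a ∣ 1 → IsUnit A
single-support-unit A a supp≡a A[a]∣1 = monomial-unit A a (∣1⇒≡1 A[a]∣1)
  λ n n≢a → decidable-stable (_ ≟ 0) (n≢a ∘ supp≡a n)

least-supp : ∀ xs → (∃ λ m → m ∈suppL xs × ∀ d → d ∈suppL xs → m ≤ d) ⊎ (∀ d → lookupD xs d ≡ 0)
least-supp []       = inj₂ λ _ → refl
least-supp (x ∷ xs) with x ≟ 0 | least-supp xs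
... | no  x≢0 | _                  = inj₁ (0 , x≢0 , λ _ _ → z≤n)
... | yes x≡0 | inj₁ (m , m∈ , m≤) = inj₁ (suc m , m∈ , λ where
  zero    0∈ → ⊥-elim (0∈ x≡0)
  (suc d) d∈ → s≤s (m≤ d d∈))
... | yes x≡0 | inj₂ xs≡0          = inj₂ λ where
  zero    → x≡0
  (suc d) → xs≡0 d

greatest-supp : ∀ xs → (∃ λ M → M ∈suppL xs × ∀ d → d ∈suppL xs → d ≤ M) ⊎ (∀ d → lookupD xs d ≡ 0)
greatest-supp []       = inj₂ λ _ → refl
greatest-supp (x ∷ xs) with greatest-supp xs | x ≟ 0
... | inj₁ (M , M∈ , ≤M) | _        = inj₁ (suc M , M∈ , λ where
  zero    _  → z≤n
  (suc d) d∈ → s≤s (≤M d d∈))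
... | inj₂ xs≡0          | no  x≢0 = inj₁ (0 , x≢0 , λ where
  zero    _  → z≤n
  (suc d) d∈ → ⊥-elim (d∈ (xs≡0 d)))
... | inj₂ xs≡0          | yes x≡0 = inj₂ λ where
  zero    → x≡0
  (suc d) → xs≡0 d

extremaL : ∀ xs i → i ∈suppL xs → ∃₂ (Extrema _≤_ (_∈suppL xs))
extremaL xs i i∈ with least-supp xs | greatest-supp xs
... | inj₂ xs≡0 | _         = ⊥-elim (i∈ (xs≡0 i))
... | inj₁ _    | inj₂ xs≡0 = ⊥-elim (i∈ (xs≡0 i))
... | inj₁ (m , m∈ , m≤) | inj₁ (M , M∈ , ≤M) =
  m , M , record { min∈ = m∈ ; max∈ = M∈ ; min≤ = m≤ ; ≤max = ≤M }

Extrema-< : ∀ {P : ℕ → Set} {m M} → Extrema _≤_ P m M → ∀ i k → P i → P k → i < k → m < M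
Extrema-< ext i k i∈ k∈ i<k = ≤-<-trans (Extrema.min≤ ext i i∈) (<-≤-trans i<k (Extrema.≤max ext k k∈))

lp-supp-∈ : ∀ l xs d → d ∈suppL xs → (l ℤ.+ pos d) ∈supp lp l xs
lp-supp-∈ l xs d d∈ = d∈ ∘ trans (sym (coeff-lp l xs d))

Extrema-lp : ∀ l xs {m M} → Extrema _≤_ (_∈suppL xs) m M →
  Extrema ℤ._≤_ (_∈supp lp l xs) (l ℤ.+ pos m) (l ℤ.+ pos M)
Extrema-lp l xs ext = record
  { min∈ = lp-supp-∈ l xs _ min∈
  ; max∈ = lp-supp-∈ l xs _ max∈
  ; min≤ = λ n n∈ → case lp-support l xs n n∈ of λ where
      (d , refl , d∈) → ℤ.+-monoʳ-≤ l (ℤ.+≤+ (min≤ d d∈))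
  ; ≤max = λ n n∈ → case lp-support l xs n n∈ of λ where
      (d , refl , d∈) → ℤ.+-monoʳ-≤ l (ℤ.+≤+ (≤max d d∈))
  }
  where open Extrema ext

extrema-supp : ∀ f n → n ∈supp f → ∃₂ (Extrema ℤ._≤_ (_∈supp f))
extrema-supp (lp l xs) n n∈ with lp-support l xs n n∈
... | i , _ , i∈ with extremaL xs i i∈
... | m , M , ext = l ℤ.+ pos m , l ℤ.+ pos M , Extrema-lp l xs ext

-- If h = A ⊗ B with neither factor a monomial, then min A + max B and max A + min B are
-- two inner points of supp h summing to min h + max h. A monomial factor c x^a is a unit
-- because c divides the coefficient 1 of h.
NoInnerPair⇒factor-unit : ∀ h m M → Extrema ℤ._≤_ (_∈supp h) m M →
  NoInnerPair ℤ._<_ ℤ._+_ (_∈supp h) m M → (∃ λ e → coeff h e ≡ 1) →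
  ∀ A B → h ≈ A ⊗ B → IsUnit A ⊎ IsUnit B
NoInnerPair⇒factor-unit h m M ext no-pair (e , h[e]≡1) A B h≈AB
  with ⊗-support A B m (≈-supp (sym ∘ h≈AB) m (Extrema.min∈ ext))
     | ⊗-support A B M (≈-supp (sym ∘ h≈AB) M (Extrema.max∈ ext))
... | a₁ , b₁ , a₁+b₁≡m , a₁∈ , b₁∈ | aᵣ , bᵣ , aᵣ+bᵣ≡M , aᵣ∈ , bᵣ∈
  with extrema-supp A a₁ a₁∈ | extrema-supp B b₁ b₁∈
... | am , aM , extA | bm , bM , extB = decide (am ℤ.<? aM) (bm ℤ.<? bM)
  where
  open Extrema

  in-h : ∀ a b → a ∈supp A → b ∈supp B → (a ℤ.+ b) ∈supp h
  in-h a b a∈ b∈ = ≈-supp h≈AB (a ℤ.+ b) (⊗-nonzero A B a b a∈ b∈)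

  min≡ : am ℤ.+ bm ≡ m
  min≡ = ℤ.≤-antisym
    (subst (am ℤ.+ bm ℤ.≤_) a₁+b₁≡m (ℤ.+-mono-≤ (min≤ extA a₁ a₁∈) (min≤ extB b₁ b₁∈)))
    (min≤ ext _ (in-h am bm (min∈ extA) (min∈ extB)))

  max≡ : aM ℤ.+ bM ≡ M
  max≡ = ℤ.≤-antisym
    (≤max ext _ (in-h aM bM (max∈ extA) (max∈ extB)))
    (subst (ℤ._≤ aM ℤ.+ bM) aᵣ+bᵣ≡M (ℤ.+-mono-≤ (≤max extA aᵣ aᵣ∈) (≤max extB bᵣ bᵣ∈)))

  single : ∀ C {c C′} → Extrema ℤ._≤_ (_∈supp C) c C′ → ¬ c ℤ.< C′ → ∀ n → n ∈supp C → n ≡ c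
  single C extC c≮C′ n n∈ = ℤ.≤-antisym (ℤ.≤-trans (≤max extC n n∈) (ℤ.≮⇒≥ c≮C′)) (min≤ extC n n∈)

  divides-1 : ∀ {c} → (∀ n → c ∣ coeff (A ⊗ B) n) → c ∣ 1
  divides-1 c∣AB = subst (_ ∣_) (trans (sym (h≈AB e)) h[e]≡1) (c∣AB e)

  swap : ∀ a b c d → a ℤ.+ b ℤ.+ (c ℤ.+ d) ≡ a ℤ.+ d ℤ.+ (c ℤ.+ b)
  swap = solve-∀

  decide : Dec (am ℤ.< aM) → Dec (bm ℤ.< bM) → IsUnit A ⊎ IsUnit B
  decide (no am≮aM) _ = inj₁ (single-support-unit A am (single A extA am≮aM)
    (divides-1 (∣-⊗ˡ A B (single-support-∣ A am (single A extA am≮aM)))))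
  decide (yes _) (no bm≮bM) = inj₂ (single-support-unit B bm (single B extB bm≮bM)
    (divides-1 (∣-⊗ʳ A B (single-support-∣ B bm (single B extB bm≮bM)))))
  decide (yes am<aM) (yes bm<bM) = ⊥-elim (no-pair (am ℤ.+ bM) (aM ℤ.+ bm)
    (in-h am bM (min∈ extA) (max∈ extB)) (in-h aM bm (max∈ extA) (min∈ extB))
    (subst (ℤ._< am ℤ.+ bM) min≡ (ℤ.+-monoʳ-< am bm<bM))
    (subst (am ℤ.+ bM ℤ.<_) max≡ (ℤ.+-monoˡ-< bM am<aM))
    (subst (ℤ._< aM ℤ.+ bm) min≡ (ℤ.+-monoˡ-< bm am<aM))
    (subst (aM ℤ.+ bm ℤ.<_) max≡ (ℤ.+-monoʳ-< aM bm<bM))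
    (trans (swap am bM aM bm) (cong₂ ℤ._+_ min≡ max≡)))

NoInnerPair-lp : ∀ l xs {m M} → NoInnerPair _<_ _+_ (_∈suppL xs) m M →
  NoInnerPair ℤ._<_ ℤ._+_ (_∈supp lp l xs) (l ℤ.+ pos m) (l ℤ.+ pos M)
NoInnerPair-lp l xs {m} {M} no-pair u v u∈ v∈ m<u u<M m<v v<M u+v≡m+M
  with lp-support l xs u u∈ | lp-support l xs v v∈
... | i , refl , i∈ | j , refl , j∈ = no-pair i j i∈ j∈
  (shift-cancel-< l m i m<u) (shift-cancel-< l i M u<M)
  (shift-cancel-< l m j m<v) (shift-cancel-< l j M v<M) (shift-cancel-+ l i j m M u+v≡m+M)

lp-irreducible : ∀ l hs {m M} → Extrema _≤_ (_∈suppL hs) m M →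
  NoInnerPair _<_ _+_ (_∈suppL hs) m M → (∃ λ e → lookupD hs e ≡ 1) → 2 ≤ sum hs →
  Irreducible (lp l hs)
lp-irreducible l hs ext no-pair (e , hs[e]≡1) 2≤sum =
  (λ h≈0 → <⇒≢ (<-trans z<s 2≤sum) (sym (eval1-cong (lp l hs) zeroLP h≈0))) ,
  (λ unit → <⇒≢ 2≤sum (sym (IsUnit⇒eval1≡1 (lp l hs) unit))) ,
  NoInnerPair⇒factor-unit (lp l hs) _ _ (Extrema-lp l hs ext) (NoInnerPair-lp l hs no-pair)
    (l ℤ.+ pos e , trans (coeff-lp l hs e) hs[e]≡1)

-- Splitting the coefficient list

data Side : Set where
  below centre above : Side

_≟ˢ_ : (s t : Side) → Dec (s ≡ t)
below  ≟ˢ below  = yes refl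
centre ≟ˢ centre = yes refl
above  ≟ˢ above  = yes refl
below  ≟ˢ centre = no λ ()
below  ≟ˢ above  = no λ ()
centre ≟ˢ below  = no λ ()
centre ≟ˢ above  = no λ ()
above  ≟ˢ below  = no λ ()
above  ≟ˢ centre = no λ ()

pick : Side → Side → ℕ → ℕ
pick s t x with t ≟ˢ s
... | yes _ = x
... | no  _ = 0

pick-≤ : ∀ s t x → pick s t x ≤ x
pick-≤ s t x with t ≟ˢ s
... | yes _ = ≤-refl
... | no  _ = z≤n

pick-nonzero : ∀ s t x → pick s t x ≢ 0 → t ≡ s
pick-nonzero s t x nz with t ≟ˢ s
... | yes t≡s = t≡s
... | no  _   = ⊥-elim (nz refl)

pick-other : ∀ s t x → t ≢ s → pick s t x ≡ 0
pick-other s t x t≢s with t ≟ˢ s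
... | yes t≡s = ⊥-elim (t≢s t≡s)
... | no  _   = refl

pick-split : ∀ t x → x ≡ pick below t x + pick centre t x + pick above t x
pick-split below  x = sym (trans (+-identityʳ _) (+-identityʳ x))
pick-split centre x = sym (+-identityʳ x)
pick-split above  x = refl

restrict : (ℕ → Side) → Side → List ℕ → List ℕ
restrict c s []       = []
restrict c s (x ∷ xs) = pick s (c 0) x ∷ restrict (c ∘ suc) s xs

lookupD-restrict : ∀ c s xs d → lookupD (restrict c s xs) d ≡ pick s (c d) (lookupD xs d)
lookupD-restrict c s []       d       = sym (n≤0⇒n≡0 (pick-≤ s (c d) 0))
lookupD-restrict c s (x ∷ xs) zero    = refl
lookupD-restrict c s (x ∷ xs) (suc d) = lookupD-restrict (c ∘ suc) s xs d

restrict-≤ : ∀ c s xs d → lookupD (restrict c s xs) d ≤ lookupD xs d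
restrict-≤ c s xs d = subst (_≤ lookupD xs d) (sym (lookupD-restrict c s xs d)) (pick-≤ s (c d) _)

restrict-supp : ∀ c s xs d → d ∈suppL restrict c s xs → c d ≡ s
restrict-supp c s xs d d∈ = pick-nonzero s (c d) _ (d∈ ∘ trans (lookupD-restrict c s xs d))

restrict-other : ∀ c s xs d → c d ≢ s → lookupD (restrict c s xs) d ≡ 0
restrict-other c s xs d cd≢s = trans (lookupD-restrict c s xs d) (pick-other s (c d) _ cd≢s)

sum-restrict : ∀ c xs →
  sum xs ≡ sum (restrict c below xs) + sum (restrict c centre xs) + sum (restrict c above xs)
sum-restrict c []       = refl
sum-restrict c (x ∷ xs) = begin
  x + sum xs                                    ≡⟨ cong₂ _+_ (pick-split (c 0) x) (sum-restrict (c ∘ suc) xs) ⟩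
  pb + pc + pa + (Rb + Rc + Ra)                 ≡⟨ interchange (pb + pc) pa (Rb + Rc) Ra ⟩
  pb + pc + (Rb + Rc) + (pa + Ra)               ≡⟨ cong (_+ (pa + Ra)) (interchange pb pc Rb Rc) ⟩
  pb + Rb + (pc + Rc) + (pa + Ra)               ∎
  where
  open ≡-Reasoning
  pb = pick below (c 0) x
  pc = pick centre (c 0) x
  pa = pick above (c 0) x
  Rb = sum (restrict (c ∘ suc) below xs)
  Rc = sum (restrict (c ∘ suc) centre xs)
  Ra = sum (restrict (c ∘ suc) above xs)

takeMass : ℕ → List ℕ → List ℕ
takeMass k []       = []
takeMass k (x ∷ xs) = x ⊓ k ∷ takeMass (k ∸ x) xs

takeMass-≤ : ∀ k xs d → lookupD (takeMass k xs) d ≤ lookupD xs d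
takeMass-≤ k []       d       = z≤n
takeMass-≤ k (x ∷ xs) zero    = m⊓n≤m x k
takeMass-≤ k (x ∷ xs) (suc d) = takeMass-≤ (k ∸ x) xs d

sum-takeMass : ∀ k xs → k ≤ sum xs → sum (takeMass k xs) ≡ k
sum-takeMass k []       k≤0 = sym (n≤0⇒n≡0 k≤0)
sum-takeMass k (x ∷ xs) k≤ with ≤-total k x
... | inj₁ k≤x rewrite m≥n⇒m⊓n≡n k≤x | m≤n⇒m∸n≡0 k≤x =
  trans (cong (k +_) (sum-takeMass 0 xs z≤n)) (+-identityʳ k)
... | inj₂ x≤k rewrite m≤n⇒m⊓n≡m x≤k =
  trans (cong (x +_) (sum-takeMass (k ∸ x) xs k∸x≤)) (m+[n∸m]≡n x≤k)
  where
  k∸x≤ : k ∸ x ≤ sum xs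
  k∸x≤ = subst (k ∸ x ≤_) (m+n∸m≡n x (sum xs)) (∸-monoˡ-≤ x k≤)

monomial : ℕ → List ℕ
monomial x = replicate x 0 ++ 1 ∷ []

monomial-at : ∀ x → lookupD (monomial x) x ≡ 1
monomial-at zero    = refl
monomial-at (suc x) = monomial-at x

monomial-off : ∀ x d → d ≢ x → lookupD (monomial x) d ≡ 0
monomial-off zero    zero    d≢x = ⊥-elim (d≢x refl)
monomial-off zero    (suc d) _   = refl
monomial-off (suc x) zero    _   = refl
monomial-off (suc x) (suc d) d≢x = monomial-off x d (d≢x ∘ cong suc)

sum-monomial : ∀ x → sum (monomial x) ≡ 1
sum-monomial zero    = refl
sum-monomial (suc x) = sum-monomial x

subP : List ℕ → List ℕ → List ℕ
subP []       _        = []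
subP (x ∷ xs) []       = x ∷ xs
subP (x ∷ xs) (y ∷ ys) = x ∸ y ∷ subP xs ys

lookupD-subP : ∀ xs ys d → lookupD (subP xs ys) d ≡ lookupD xs d ∸ lookupD ys d
lookupD-subP []       ys       d       = sym (0∸n≡0 (lookupD ys d))
lookupD-subP (x ∷ xs) []       zero    = refl
lookupD-subP (x ∷ xs) []       (suc d) = refl
lookupD-subP (x ∷ xs) (y ∷ ys) zero    = refl
lookupD-subP (x ∷ xs) (y ∷ ys) (suc d) = lookupD-subP xs ys d

anchored : ℕ → ℕ → List ℕ → List ℕ
anchored x k ys = addP (monomial x) (takeMass k ys)

anchored-off : ∀ x k ys d → d ≢ x → lookupD (anchored x k ys) d ≡ lookupD (takeMass k ys) d
anchored-off x k ys d d≢x = trans (lookupD-addP (monomial x) _ d) (cong (_+ _) (monomial-off x d d≢x))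

takeMass-zero : ∀ k ys d → lookupD ys d ≡ 0 → lookupD (takeMass k ys) d ≡ 0
takeMass-zero k ys d ys[d]≡0 = n≤0⇒n≡0 (subst (lookupD (takeMass k ys) d ≤_) ys[d]≡0 (takeMass-≤ k ys d))

anchored-at : ∀ x k ys → lookupD ys x ≡ 0 → lookupD (anchored x k ys) x ≡ 1
anchored-at x k ys ys[x]≡0 = trans (lookupD-addP (monomial x) _ x)
  (cong₂ _+_ (monomial-at x) (takeMass-zero k ys x ys[x]≡0))

anchored-≤ : ∀ x k ys cs → x ∈suppL cs → lookupD ys x ≡ 0 →
  (∀ d → lookupD ys d ≤ lookupD cs d) → ∀ d → lookupD (anchored x k ys) d ≤ lookupD cs d
anchored-≤ x k ys cs x∈ ys[x]≡0 ys≤cs d with d ≟ x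
... | yes refl = subst (_≤ lookupD cs x) (sym (anchored-at x k ys ys[x]≡0)) (n≢0⇒n>0 x∈)
... | no  d≢x  = subst (_≤ lookupD cs d) (sym (anchored-off x k ys d d≢x))
  (≤-trans (takeMass-≤ k ys d) (ys≤cs d))

sum-anchored : ∀ x k ys → k ≤ sum ys → sum (anchored x k ys) ≡ suc k
sum-anchored x k ys k≤ =
  trans (sum-addP (monomial x) _) (cong₂ _+_ (sum-monomial x) (sum-takeMass k ys k≤))

anchored-supp : ∀ x k ys d → d ∈suppL anchored x k ys → d ≡ x ⊎ d ∈suppL ys
anchored-supp x k ys d d∈ with d ≟ x
... | yes d≡x = inj₁ d≡x
... | no  d≢x = inj₂ λ ys[d]≡0 → d∈ (trans (anchored-off x k ys d d≢x) (takeMass-zero k ys d ys[d]≡0))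

side : ℕ → ℕ → Side
side σ d with <-cmp (2 * d) σ
... | tri< _ _ _ = below
... | tri≈ _ _ _ = centre
... | tri> _ _ _ = above

SideOf : Side → ℕ → ℕ → Set
SideOf below  σ d = 2 * d < σ
SideOf centre σ d = 2 * d ≡ σ
SideOf above  σ d = σ < 2 * d

side-sound : ∀ σ d {s} → side σ d ≡ s → SideOf s σ d
side-sound σ d refl with <-cmp (2 * d) σ
... | tri< lt _ _ = lt
... | tri≈ _ eq _ = eq
... | tri> _ _ gt = gt

2*n≡n+n : ∀ n → 2 * n ≡ n + n
2*n≡n+n n = cong (n +_) (+-identityʳ n)

mean-< : ∀ u v {σ} → 2 * u < σ → 2 * v < σ → u + v < σ
mean-< u v {σ} 2u<σ 2v<σ = *-cancelˡ-< 2 (u + v) σ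
  (subst₂ _<_ (sym (*-distribˡ-+ 2 u v)) (sym (2*n≡n+n σ)) (+-mono-< 2u<σ 2v<σ))

mean-> : ∀ u v {σ} → σ < 2 * u → σ < 2 * v → σ < u + v
mean-> u v {σ} σ<2u σ<2v = *-cancelˡ-< 2 σ (u + v)
  (subst₂ _<_ (sym (2*n≡n+n σ)) (sym (*-distribˡ-+ 2 u v)) (+-mono-< σ<2u σ<2v))

module Span (t₁ tₖ : ℕ) where

  σ : ℕ
  σ = t₁ + tₖ

  anchor : Side → ℕ
  anchor below  = tₖ
  anchor centre = t₁
  anchor above  = t₁

  anchor∈ : ∀ {P} → Extrema _≤_ P t₁ tₖ → ∀ s → P (anchor s)
  anchor∈ ext below  = Extrema.max∈ ext
  anchor∈ ext centre = Extrema.min∈ ext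
  anchor∈ ext above  = Extrema.min∈ ext

  2t₁<σ : t₁ < tₖ → 2 * t₁ < σ
  2t₁<σ t₁<tₖ = subst (_< σ) (sym (2*n≡n+n t₁)) (+-monoʳ-< t₁ t₁<tₖ)

  σ<2tₖ : t₁ < tₖ → σ < 2 * tₖ
  σ<2tₖ t₁<tₖ = subst (σ <_) (sym (2*n≡n+n tₖ)) (+-monoˡ-< tₖ t₁<tₖ)

  anchor-side : t₁ < tₖ → ∀ s → side σ (anchor s) ≢ s
  anchor-side t₁<tₖ below  eq = <-asym (side-sound σ tₖ eq) (σ<2tₖ t₁<tₖ)
  anchor-side t₁<tₖ centre eq = <⇒≢ (2t₁<σ t₁<tₖ) (side-sound σ t₁ eq)
  anchor-side t₁<tₖ above  eq = <-asym (side-sound σ t₁ eq) (2t₁<σ t₁<tₖ)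

  module _ {P : ℕ → Set} {m M} (ext : Extrema _≤_ P m M) (bounds : ∀ d → P d → t₁ ≤ d × d ≤ tₖ) where
    open Extrema ext

    t₁≤m : t₁ ≤ m
    t₁≤m = proj₁ (bounds m min∈)

    M≤tₖ : M ≤ tₖ
    M≤tₖ = proj₂ (bounds M max∈)

    off-anchor : ∀ s → (∀ d → P d → d ≡ anchor s ⊎ SideOf s σ d) → ∀ d → P d → d ≢ anchor s → SideOf s σ d
    off-anchor s shape d d∈ d≢ = [ ⊥-elim ∘ d≢ , id ]′ (shape d d∈)

    -- The anchor pins one end of the support and every other point lies on side s of the
    -- midpoint σ / 2, so two inner points sum to strictly less, resp. more, than the two
    -- ends; on the centre there is room for only one inner point.
    NoInnerPair-anchored : ∀ s → P (anchor s) → (∀ d → P d → d ≡ anchor s ⊎ SideOf s σ d) →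
      NoInnerPair _<_ _+_ P m M
    NoInnerPair-anchored below tₖ∈ shape u v u∈ v∈ _ u<M _ v<M = <⇒≢ (<-≤-trans
      (mean-< u v (off-anchor below shape u u∈ (<⇒≢ (<-≤-trans u<M M≤tₖ)))
              (off-anchor below shape v v∈ (<⇒≢ (<-≤-trans v<M M≤tₖ))))
      (+-mono-≤ t₁≤m (≤max tₖ tₖ∈)))
    NoInnerPair-anchored centre _ shape u _ u∈ _ m<u u<M _ _ _ = <⇒≢ u<M (*-cancelˡ-≡ u M 2 (trans
      (off-anchor centre shape u u∈ (>⇒≢ (≤-<-trans t₁≤m m<u)))
      (sym (off-anchor centre shape M max∈ (>⇒≢ (≤-<-trans t₁≤m (<-trans m<u u<M)))))))
    NoInnerPair-anchored above t₁∈ shape u v u∈ v∈ m<u _ m<v _ = >⇒≢ (≤-<-trans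
      (+-mono-≤ (min≤ t₁ t₁∈) M≤tₖ)
      (mean-> u v (off-anchor above shape u u∈ (>⇒≢ (≤-<-trans t₁≤m m<u)))
              (off-anchor above shape v v∈ (>⇒≢ (≤-<-trans t₁≤m m<v)))))

record IrreduciblePart (cs : List ℕ) (k : ℕ) : Set where
  field
    part        : List ℕ
    part≤cs     : ∀ d → lookupD part d ≤ lookupD cs d
    sum-part    : sum part ≡ k
    irreducible : ∀ l → Irreducible (lp l part)

heavy-part : ∀ cs {t₁ tₖ} → Extrema _≤_ (_∈suppL cs) t₁ tₖ → t₁ < tₖ →
  ∀ r s → r < sum (restrict (side (t₁ + tₖ)) s cs) → IrreduciblePart cs (2 + r)
heavy-part cs {t₁} {tₖ} ext t₁<tₖ r s heavy = record
  { part        = hs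
  ; part≤cs     = hs≤cs
  ; sum-part    = sum-hs
  ; irreducible = λ l → case extremaL hs x x∈hs of λ where
      (m , M , ext-hs) → lp-irreducible l hs ext-hs
        (NoInnerPair-anchored ext-hs bounds s x∈hs shape)
        (x , anchored-at x (suc r) ys ys[x]≡0) (subst (2 ≤_) (sym sum-hs) (m≤m+n 2 r))
  }
  where
  open Span t₁ tₖ
  open Extrema ext
  ys = restrict (side σ) s cs
  x  = anchor s
  hs = anchored x (suc r) ys

  x∈cs : x ∈suppL cs
  x∈cs = anchor∈ ext s

  ys[x]≡0 : lookupD ys x ≡ 0
  ys[x]≡0 = restrict-other (side σ) s cs x (anchor-side t₁<tₖ s)

  sum-hs : sum hs ≡ 2 + r
  sum-hs = sum-anchored x (suc r) ys heavy

  hs≤cs : ∀ d → lookupD hs d ≤ lookupD cs d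
  hs≤cs = anchored-≤ x (suc r) ys cs x∈cs ys[x]≡0 (restrict-≤ (side σ) s cs)

  x∈hs : x ∈suppL hs
  x∈hs hs[x]≡0 = 1+n≢0 (trans (sym (anchored-at x (suc r) ys ys[x]≡0)) hs[x]≡0)

  bounds : ∀ d → d ∈suppL hs → t₁ ≤ d × d ≤ tₖ
  bounds d d∈ = min≤ d d∈cs , ≤max d d∈cs
    where
    d∈cs : d ∈suppL cs
    d∈cs cs[d]≡0 = d∈ (n≤0⇒n≡0 (subst (lookupD hs d ≤_) cs[d]≡0 (hs≤cs d)))

  shape : ∀ d → d ∈suppL hs → d ≡ x ⊎ SideOf s σ d
  shape d d∈ = map₂ (side-sound σ d ∘ restrict-supp (side σ) s cs d)
    (anchored-supp x (suc r) ys d d∈)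

split-off : ∀ l cs {p k} → Prime p → sum cs ≡ p + k → IrreduciblePart cs k →
  Σ LP λ g → Σ LP λ h → Irreducible g × Irreducible h × lp l cs ≈ g ⊕ h
split-off l cs {p} {k} p-prime sum≡p+k H =
  lp l rest , lp l part ,
  prime-eval1⇒Irreducible (lp l rest) (subst Prime (sym sum-rest) p-prime) ,
  irreducible l ,
  λ n → trans (lp-cong l cs (addP rest part) cs≗rest+part n) (sym (⊕-lp l rest part n))
  where
  open IrreduciblePart H
  rest = subP cs part
  cs≗rest+part : lookupD cs ≗ lookupD (addP rest part)
  cs≗rest+part d = sym (begin
    lookupD (addP rest part) d                      ≡⟨ lookupD-addP rest part d ⟩
    lookupD rest d + lookupD part d                 ≡⟨ cong (_+ lookupD part d) (lookupD-subP cs part d) ⟩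
    lookupD cs d ∸ lookupD part d + lookupD part d  ≡⟨ m∸n+n≡m (part≤cs d) ⟩
    lookupD cs d                                    ∎)
    where open ≡-Reasoning
  sum-rest : sum rest ≡ p
  sum-rest = +-cancelʳ-≡ k (sum rest) p (begin
    sum rest + k               ≡⟨ cong (sum rest +_) sum-part ⟨
    sum rest + sum part        ≡⟨ sum-addP rest part ⟨
    sum (addP rest part)       ≡⟨ sum-≗ cs (addP rest part) cs≗rest+part ⟨
    sum cs                     ≡⟨ sum≡p+k ⟩
    p + k                      ∎)
    where open ≡-Reasoning

heavy-side : ∀ (w : Side → ℕ) r → r + r + r < w below + w centre + w above → ∃ λ s → r < w s
heavy-side w r 3r< with r <? w below | r <? w centre | r <? w above
... | yes heavy | _         | _         = below , heavy
... | no  _     | yes heavy | _         = centre , heavy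
... | no  _     | no  _     | yes heavy = above , heavy
... | no  b     | no  c     | no  a     =
  ⊥-elim (<⇒≱ 3r< (+-mono-≤ (+-mono-≤ (≮⇒≥ b) (≮⇒≥ c)) (≮⇒≥ a)))

five-sixths-bound : ∀ p r → 5 * (p + (2 + r)) ≤ 6 * (p + 1) → r + r + r < p + (2 + r)
five-sixths-bound p r 5n≤ = <-≤-trans 3r<6[r+1] 6[r+1]≤n
  where
  open ≤-Reasoning
  n = p + (2 + r)
  6[r+1]≤n : 6 * (r + 1) ≤ n
  6[r+1]≤n = +-cancelˡ-≤ (5 * n) _ _ (begin
    5 * n + 6 * (r + 1)          ≤⟨ +-monoˡ-≤ (6 * (r + 1)) 5n≤ ⟩
    6 * (p + 1) + 6 * (r + 1)    ≡⟨ identity p r ⟩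
    5 * n + n                    ∎)
    where
    identity : ∀ p r → 6 * (p + 1) + 6 * (r + 1) ≡ 5 * (p + (2 + r)) + (p + (2 + r))
    identity = ℕ-solve-∀
  3r<6[r+1] : r + r + r < 6 * (r + 1)
  3r<6[r+1] = begin-strict
    r + r + r                    <⟨ m<m+n (r + r + r) z<s ⟩
    r + r + r + (6 + 3 * r)      ≡⟨ identity r ⟩
    6 * (r + 1)                  ∎
    where
    identity : ∀ r → r + r + r + (6 + 3 * r) ≡ 6 * (r + 1)
    identity = ℕ-solve-∀

decompose : ∀ l cs {t₁ tₖ} → Extrema _≤_ (_∈suppL cs) t₁ tₖ → t₁ < tₖ →
  ∀ {p} → Prime p → 5 * sum cs ≤ 6 * (p + 1) → p + 2 ≤ sum cs →
  Σ LP λ g → Σ LP λ h → Irreducible g × Irreducible h × lp l cs ≈ g ⊕ h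
decompose l cs {t₁} {tₖ} ext t₁<tₖ {p} p-prime 5N≤ p+2≤N =
  split-off l cs p-prime N≡ (uncurry (heavy-part cs ext t₁<tₖ r) (heavy-side mass r 3r<N))
  where
  r = sum cs ∸ (p + 2)
  N≡ : sum cs ≡ p + (2 + r)
  N≡ = trans (sym (m+[n∸m]≡n p+2≤N)) (+-assoc p 2 r)
  mass : Side → ℕ
  mass s = sum (restrict (side (t₁ + tₖ)) s cs)
  3r<N : r + r + r < mass below + mass centre + mass above
  3r<N = subst (r + r + r <_) (trans (sym N≡) (sum-restrict (side (t₁ + tₖ)) cs))
    (five-sixths-bound p r (subst (λ n → 5 * n ≤ 6 * (p + 1)) N≡ 5N≤))

-- The coefficient at the middle exponent j is not needed: two support points suffice.
lemma2p10 : (f : LP) → SuppAtLeast3 f →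
    (p : ℕ) → Prime p → 5 * eval1 f ≤ 6 * (p + 1) → p + 2 ≤ eval1 f →
    Σ LP λ g → Σ LP λ h → Irreducible g × Irreducible h × f ≈ g ⊕ h
lemma2p10 (lp l cs) (i , j , k , i<j , j<k , i∈ , _ , k∈) p p-prime 5N≤ p+2≤N
  with lp-support l cs i i∈ | lp-support l cs k k∈
... | i′ , refl , i′∈ | k′ , refl , k′∈ with extremaL cs i′ i′∈
... | t₁ , tₖ , ext = decompose l cs ext t₁<tₖ p-prime 5N≤ p+2≤N
  where
  t₁<tₖ : t₁ < tₖ
  t₁<tₖ = Extrema-< ext i′ k′ i′∈ k′∈ (shift-cancel-< l i′ k′ (ℤ.<-trans i<j j<k))
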